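{- Let $k$ be an integer with $4 \mid k$. Then every prime factor of every element of $C_k$ is either $2$ or congruent to $3 \pmod 4$.
   Context: For an integer $k$, $C_k$ denotes the set of integers $n>\max(k,0)$ such that $a^{n-k+1}\equiv a \pmod{n}$ for all integers $a$. -}

module Defs where

open import Data.Nat using (ℕ)
import Data.Nat as ℕ
open import Data.Integer using (ℤ; +_; _-_; _+_; _^_; _>_; ∣_∣)
open import Data.Integer.Divisibility using (_∣_)
open import Data.Product using (_×_)

-- exponent n - k + 1 (as a natural number; it is ≥ 2 whenever n > k)
expo : ℤ → ℕ → ℕ
expo k n = ∣ (+ n) - k + + 1 ∣

InC : ℤ → ℕ → Set
InC k n = (n ℕ.> 0) × ((+ n) > k) × (∀ (a : ℤ) → (+ n) ∣ (a ^ expo k n - a))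

-- Let p be a prime factor of some n ∈ C_k with 4 ∣ k, and suppose p ≡ 1 (mod 4). Pairing every
-- unit y modulo p with y⁻¹ proves Wilson's theorem, (p − 1)! ≡ −1. If −1 were not a square, pairing
-- y with −y⁻¹ instead would have no fixed points and give (p − 1)! ≡ (−1)^((p − 1)/2) = 1; so there
-- is an i with i² ≡ −1. This i has order 4 and satisfies i^e ≡ i for e = n − k + 1, hence
-- e ≡ 1 (mod 4), i.e. 4 ∣ n − k, and with 4 ∣ k also 4 ∣ n. But n ∣ 2^e − 2 and e ≥ 2, so then
-- 4 ∣ 2^e − 2 and 4 ∣ 2^e, which is absurd.

module Submission where

open import Defs
open import Data.Nat using (ℕ; _%_)
open import Data.Nat.Divisibility using (_∣_)
open import Data.Nat.Primality using (Prime)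
open import Data.Integer using (ℤ)
import Data.Integer.Divisibility as ℤd
open import Data.Integer using (+_)
open import Data.Sum using (_⊎_)
open import Relation.Binary.PropositionalEquality using (_≡_)

open import Algebra.Bundles using (CommutativeMonoid)
open import Algebra.Structures using (IsCommutativeMonoid)
open import Data.Empty using (⊥-elim)
open import Data.Fin using (toℕ; fromℕ<)
open import Data.Fin.Properties using (any?; toℕ-fromℕ<)
open import Data.Integer using (-_; _+_; _-_; _*_; _^_; _⊖_; _<_; 0ℤ; 1ℤ; -1ℤ; ∣_∣)
open import Data.Integer.DivMod using (_%ℕ_; _/ℕ_; n%ℕd<d; a≡a%ℕn+[a/ℕn]*n)
open import Data.Integer.Divisibility.Signed
  using (divides; ∣ᵤ⇒∣; ∣⇒∣ᵤ; ∣m∣n⇒∣m+n; ∣m∣n⇒∣m-n; ∣m⇒∣-m; ∣n⇒∣m*n; ∣m⇒∣m*n; _∣?_)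
  renaming (_∣_ to _∣ᶻ_)
import Data.Integer.Properties as ℤ
open import Data.Integer.Tactic.RingSolver using (solve-∀)
open import Data.List using (List; []; _∷_; _++_; length; map; foldr; replicate; applyUpTo)
open import Data.List.Membership.Propositional using (_∈_)
open import Data.List.Membership.Propositional.Properties using (∈-∃++; ∈-applyUpTo⁺; ∈-applyUpTo⁻)
open import Data.List.Properties using (length-applyUpTo)
import Data.List.Relation.Unary.All as All
open import Data.List.Relation.Unary.AllPairs using (_∷_)
open import Data.List.Relation.Unary.Any using (here; there)
open import Data.List.Relation.Unary.Unique.Propositional using (Unique)
open import Data.List.Relation.Unary.Unique.Propositional.Properties using (applyUpTo⁺₁)
open import Data.List.Relation.Binary.Permutation.Propositional using (_↭_; ↭-sym; ↭-prep; ↭⇒↭ₛ; ↭⇒↭ₛ′)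
open import Data.List.Relation.Binary.Permutation.Propositional.Properties
  using (∈-resp-↭; ↭-length; shift; map⁺)
import Data.List.Relation.Binary.Permutation.Setoid.Properties as SetoidPermutation
open import Data.Nat using (suc)
import Data.Nat as ℕ
import Data.Nat.DivMod as ℕ
import Data.Nat.Properties as ℕ
import Data.Nat.Divisibility as ND
open import Data.Nat.Coprimality using (coprime⇒GCD≡1; prime⇒coprime)
open import Data.Nat.GCD using (module GCD; module Bézout)
open import Data.Nat.Induction using (<-wellFounded)
open import Data.Nat.Primality using (prime⇒nonZero; prime⇒irreducible; euclidsLemma; ¬prime[0]; ¬prime[1])
import Data.Nat.Tactic.RingSolver as ℕ-Solver
open import Data.Product using (_×_; _,_; proj₁; proj₂; ∃-syntax)
import Data.Product as Σ
open import Data.Sum using (inj₁; inj₂; [_,_]′)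
import Data.Sum as Sum
open import Function using (_∘_; id)
open import Induction.WellFounded using (Acc; acc)
open import Level using (0ℓ)
open import Relation.Binary.Bundles using (Setoid)
open import Relation.Binary.Structures using (IsEquivalence)
import Relation.Binary.Reasoning.Setoid as SetoidReasoning
open import Relation.Binary.PropositionalEquality using (refl; sym; trans; cong; subst; _≢_)
import Relation.Binary.PropositionalEquality as ≡
open import Relation.Nullary using (¬_; yes; no)
import Relation.Nullary.Decidable as Dec

module Modulo (m : ℕ) where

  infix 4 _≈_ _≉_ _≈?_

  -- A record rather than [+ m ∣ x - y] so that x and y can be inferred from a proof.
  record _≈_ (x y : ℤ) : Set where
    constructor congruent
    field divides-difference : + m ∣ᶻ x - y

  open _≈_ public

  _≉_ : ℤ → ℤ → Set
  x ≉ y = ¬ (x ≈ y)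

  private
    ≈-via : ∀ {x y d} → d ≡ x - y → + m ∣ᶻ d → x ≈ y
    ≈-via refl m∣d = congruent m∣d

    difference-sym : ∀ x y → - (x - y) ≡ y - x
    difference-sym = solve-∀
    difference-trans : ∀ x y z → (x - y) + (y - z) ≡ x - z
    difference-trans = solve-∀
    difference-* : ∀ a b c d → (a - b) * c + b * (c - d) ≡ a * c - b * d
    difference-* = solve-∀
    difference-neg : ∀ a b → - (a - b) ≡ - a - - b
    difference-neg = solve-∀

  ≈-reflexive : ∀ {x y} → x ≡ y → x ≈ y
  ≈-reflexive {x} refl = ≈-via (sym (ℤ.+-inverseʳ x)) (divides 0ℤ refl)

  ≈-refl : ∀ {x} → x ≈ x
  ≈-refl = ≈-reflexive refl

  ≈-sym : ∀ {x y} → x ≈ y → y ≈ x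
  ≈-sym {x} {y} (congruent d) = ≈-via (difference-sym x y) (∣m⇒∣-m d)

  ≈-trans : ∀ {x y z} → x ≈ y → y ≈ z → x ≈ z
  ≈-trans {x} {y} {z} (congruent d) (congruent e) = ≈-via (difference-trans x y z) (∣m∣n⇒∣m+n d e)

  ≈-isEquivalence : IsEquivalence _≈_
  ≈-isEquivalence = record { refl = ≈-refl ; sym = ≈-sym ; trans = ≈-trans }

  ≈-setoid : Setoid 0ℓ 0ℓ
  ≈-setoid = record { isEquivalence = ≈-isEquivalence }

  module ≈-Reasoning = SetoidReasoning ≈-setoid

  _≈?_ : ∀ x y → Dec.Dec (x ≈ y)
  x ≈? y = Dec.map′ congruent divides-difference (+ m ∣? x - y)

  ∣⇒≈0 : ∀ {x} → + m ∣ᶻ x → x ≈ 0ℤ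
  ∣⇒≈0 {x} = ≈-via (sym (ℤ.+-identityʳ x))

  ≈0⇒∣ : ∀ {x} → x ≈ 0ℤ → + m ∣ᶻ x
  ≈0⇒∣ {x} (congruent d) = subst (+ m ∣ᶻ_) (ℤ.+-identityʳ x) d

  *-cong : ∀ {a b c d} → a ≈ b → c ≈ d → a * c ≈ b * d
  *-cong {a} {b} {c} {d} (congruent e) (congruent f) =
    ≈-via (difference-* a b c d) (∣m∣n⇒∣m+n (∣m⇒∣m*n c e) (∣n⇒∣m*n b f))

  *-congˡ : ∀ a {b c} → b ≈ c → a * b ≈ a * c
  *-congˡ a = *-cong (≈-refl {a})

  *-congʳ : ∀ a {b c} → b ≈ c → b * a ≈ c * a
  *-congʳ a b≈c = *-cong b≈c (≈-refl {a})

  -‿cong : ∀ {a b} → a ≈ b → - a ≈ - b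
  -‿cong {a} {b} (congruent e) = ≈-via (difference-neg a b) (∣m⇒∣-m e)

  ^-cong : ∀ {a b} n → a ≈ b → a ^ n ≈ b ^ n
  ^-cong ℕ.zero    a≈b = ≈-refl
  ^-cong (ℕ.suc n) a≈b = *-cong a≈b (^-cong n a≈b)

  *-isCommutativeMonoid : IsCommutativeMonoid _≈_ _*_ 1ℤ
  *-isCommutativeMonoid = record
    { isMonoid = record
      { isSemigroup = record
        { isMagma = record { isEquivalence = ≈-isEquivalence ; ∙-cong = *-cong }
        ; assoc   = λ x y z → ≈-reflexive (ℤ.*-assoc x y z)
        }
      ; identity = (λ x → ≈-reflexive (ℤ.*-identityˡ x)) , (λ x → ≈-reflexive (ℤ.*-identityʳ x))
      }
    ; comm = λ x y → ≈-reflexive (ℤ.*-comm x y)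
    }

  *-commutativeMonoid : CommutativeMonoid 0ℓ 0ℓ
  *-commutativeMonoid = record { isCommutativeMonoid = *-isCommutativeMonoid }

  1≉-1 : 2 ℕ.< m → 1ℤ ≉ -1ℤ
  1≉-1 2<m (congruent m∣2) = ND.>⇒∤ 2<m (∣⇒∣ᵤ m∣2)

  iᵉ≈i⇒e%4≡1 : 1ℤ ≉ -1ℤ → ∀ {i} e → i * i ≈ -1ℤ → i ^ e ≈ i → e % 4 ≡ 1
  iᵉ≈i⇒e%4≡1 1≉-1 {i} e i²≈-1 iᵉ≈i =
    residue≡1 (e % 4) (ℕ.m%n<n e 4) (≈-trans (≈-sym iᵉ≈iʳ) iᵉ≈i)
    where
    open ≈-Reasoning
    fourth-power : ∀ i → i * (i * (i * (i * 1ℤ))) ≡ (i * i) * (i * i)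
    fourth-power = solve-∀
    cube : ∀ i → (i * i) * i ≡ i * (i * (i * 1ℤ))
    cube = solve-∀
    i⁴≈1 : i ^ 4 ≈ 1ℤ
    i⁴≈1 = begin
      i ^ 4              ≡⟨ fourth-power i ⟩
      (i * i) * (i * i)  ≈⟨ *-cong i²≈-1 i²≈-1 ⟩
      -1ℤ * -1ℤ          ≡⟨⟩
      1ℤ                 ∎
    iᵉ≈iʳ : i ^ e ≈ i ^ (e % 4)
    iᵉ≈iʳ = begin
      i ^ e                                ≡⟨ cong (i ^_) (ℕ.m≡m%n+[m/n]*n e 4) ⟩
      i ^ (e % 4 ℕ.+ (e ℕ./ 4) ℕ.* 4)      ≡⟨ ℤ.^-distribˡ-+-* i (e % 4) _ ⟩
      i ^ (e % 4) * i ^ ((e ℕ./ 4) ℕ.* 4)  ≡⟨ cong (λ x → i ^ (e % 4) * i ^ x) (ℕ.*-comm (e ℕ./ 4) 4) ⟩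
      i ^ (e % 4) * i ^ (4 ℕ.* (e ℕ./ 4))  ≡⟨ cong (i ^ (e % 4) *_) (ℤ.^-*-assoc i 4 (e ℕ./ 4)) ⟨
      i ^ (e % 4) * (i ^ 4) ^ (e ℕ./ 4)    ≈⟨ *-congˡ (i ^ (e % 4)) (^-cong (e ℕ./ 4) i⁴≈1) ⟩
      i ^ (e % 4) * 1ℤ ^ (e ℕ./ 4)         ≡⟨ cong (i ^ (e % 4) *_) (ℤ.^-zeroˡ (e ℕ./ 4)) ⟩
      i ^ (e % 4) * 1ℤ                     ≡⟨ ℤ.*-identityʳ (i ^ (e % 4)) ⟩
      i ^ (e % 4)                          ∎
    residue≡1 : ∀ r → r ℕ.< 4 → i ^ r ≈ i → r ≡ 1
    residue≡1 0 _ 1≈i = ⊥-elim (1≉-1 (begin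
      1ℤ * 1ℤ  ≈⟨ *-cong 1≈i 1≈i ⟩
      i * i    ≈⟨ i²≈-1 ⟩
      -1ℤ      ∎))
    residue≡1 1 _ _ = refl
    residue≡1 2 _ i²≈i = ⊥-elim (1≉-1 (begin
      -1ℤ * -1ℤ  ≈⟨ *-cong -1≈i -1≈i ⟩
      i * i      ≈⟨ i²≈-1 ⟩
      -1ℤ        ∎))
      where
      -1≈i : -1ℤ ≈ i
      -1≈i = begin
        -1ℤ           ≈⟨ i²≈-1 ⟨
        i * i         ≡⟨ cong (i *_) (ℤ.*-identityʳ i) ⟨
        i * (i * 1ℤ)  ≈⟨ i²≈i ⟩
        i             ∎
    residue≡1 3 _ i³≈i = ⊥-elim (1≉-1 (begin
      - -1ℤ      ≈⟨ -‿cong i²≈-1 ⟨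
      - (i * i)  ≡⟨ ℤ.neg-distribˡ-* i i ⟩
      - i * i    ≈⟨ *-congʳ i -i≈i ⟩
      i * i      ≈⟨ i²≈-1 ⟩
      -1ℤ        ∎))
      where
      -i≈i : - i ≈ i
      -i≈i = begin
        - i        ≡⟨ ℤ.-1*i≡-i i ⟨
        -1ℤ * i    ≈⟨ *-congʳ i i²≈-1 ⟨
        (i * i) * i ≡⟨ cube i ⟩
        i ^ 3      ≈⟨ i³≈i ⟩
        i          ∎
    residue≡1 (suc (suc (suc (suc _)))) (ℕ.s≤s (ℕ.s≤s (ℕ.s≤s (ℕ.s≤s ())))) _

  residue-injective : ∀ {a b} → a ℕ.< m → b ℕ.< m → + a ≈ + b → a ≡ b
  residue-injective {a} {b} a<m b<m a≈b =
    ℤ.+-injective (ℤ.i-j≡0⇒i≡j (+ a) (+ b) (ℤ.∣i∣≡0⇒i≡0 ∣a-b∣≡0))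
    where
    ∣a-b∣<m : ∣ + a - + b ∣ ℕ.< m
    ∣a-b∣<m = begin-strict
      ∣ + a - + b ∣ ≡⟨ cong ∣_∣ (ℤ.[+m]-[+n]≡m⊖n a b) ⟩
      ∣ a ⊖ b ∣   ≤⟨ ℤ.∣m⊝n∣≤m⊔n a b ⟩
      a ℕ.⊔ b       <⟨ ℕ.⊔-lub a<m b<m ⟩
      m             ∎
      where open ℕ.≤-Reasoning
    ∣a-b∣≡0 : ∣ + a - + b ∣ ≡ 0
    ∣a-b∣≡0 with ∣ + a - + b ∣ | ∣⇒∣ᵤ (divides-difference a≈b) | ∣a-b∣<m
    ... | ℕ.zero  | _   | _   = refl
    ... | ℕ.suc _ | m∣d | d<m = ⊥-elim (ND.>⇒∤ d<m m∣d)

  %ℕ-≈ : ∀ x .{{_ : ℕ.NonZero m}} → + (x %ℕ m) ≈ x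
  %ℕ-≈ x = ≈-sym (≈-via quotient-term (divides (x /ℕ m) refl))
    where
    cancel : ∀ r s → s ≡ (r + s) - r
    cancel = solve-∀
    quotient-term : (x /ℕ m) * + m ≡ x - + (x %ℕ m)
    quotient-term = trans (cancel (+ (x %ℕ m)) _) (cong (_- + (x %ℕ m)) (sym (a≡a%ℕn+[a/ℕn]*n x m)))

module _ {a} {A : Set a} (σ : A → A) where

  record IsFixedPointFreeInvolution (xs : List A) : Set a where
    field
      unique     : Unique xs
      closed     : ∀ {x} → x ∈ xs → σ x ∈ xs
      fixedFree  : ∀ {x} → x ∈ xs → σ x ≢ x
      involutive : ∀ {x} → x ∈ xs → σ (σ x) ≡ x

  open IsFixedPointFreeInvolution

  IsFixedPointFreeInvolution-resp-↭ : ∀ {xs ys} → xs ↭ ys →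
    IsFixedPointFreeInvolution xs → IsFixedPointFreeInvolution ys
  IsFixedPointFreeInvolution-resp-↭ xs↭ys inv = record
    { unique     = SetoidPermutation.Unique-resp-↭ (≡.setoid A) (↭⇒↭ₛ xs↭ys) (unique inv)
    ; closed     = ∈-resp-↭ xs↭ys ∘ closed inv ∘ ∈-resp-↭ ys↭xs
    ; fixedFree  = fixedFree inv ∘ ∈-resp-↭ ys↭xs
    ; involutive = involutive inv ∘ ∈-resp-↭ ys↭xs
    }
    where ys↭xs = ↭-sym xs↭ys

  split-pair : ∀ {x xs} → IsFixedPointFreeInvolution (x ∷ xs) → ∃[ ys ] x ∷ xs ↭ x ∷ σ x ∷ ys
  split-pair {x} inv with closed inv (here refl)
  ... | here σx≡x = ⊥-elim (fixedFree inv (here refl) σx≡x)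
  ... | there σx∈xs with ys , zs , refl ← ∈-∃++ σx∈xs = ys ++ zs , ↭-prep x (shift (σ x) ys zs)

  drop-pair : ∀ {x ys} → IsFixedPointFreeInvolution (x ∷ σ x ∷ ys) → IsFixedPointFreeInvolution ys
  drop-pair {ys = ys} inv@record { unique = x∉ ∷ σx∉ ∷ ys-unique } = record
    { unique     = ys-unique
    ; closed     = closed′
    ; fixedFree  = fixedFree inv ∘ there ∘ there
    ; involutive = involutive inv ∘ there ∘ there
    }
    where
    closed′ : ∀ {y} → y ∈ ys → σ y ∈ ys
    closed′ {y} y∈ys with closed inv (there (there y∈ys))
    ... | here σy≡x = ⊥-elim (All.lookup σx∉ y∈ys
            (trans (cong σ (sym σy≡x)) (involutive inv (there (there y∈ys)))))
    ... | there (here σy≡σx) = ⊥-elim (All.lookup x∉ (there y∈ys)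
            (trans (sym (involutive inv (here refl)))
              (trans (cong σ (sym σy≡σx)) (involutive inv (there (there y∈ys))))))
    ... | there (there σy∈ys) = σy∈ys

module CommutativeMonoidProduct {c ℓ} (M : CommutativeMonoid c ℓ) where

  open CommutativeMonoid M
    using (Carrier; _≈_; _∙_; ε; setoid; isEquivalence; isCommutativeMonoid; assoc; ∙-cong)
    renaming (refl to ≈-refl)
  open SetoidReasoning setoid

  ∏ : List Carrier → Carrier
  ∏ = foldr _∙_ ε

  ∏-resp-↭ : ∀ {xs ys} → xs ↭ ys → ∏ xs ≈ ∏ ys
  ∏-resp-↭ = SetoidPermutation.foldr-commMonoid setoid isCommutativeMonoid ∘ ↭⇒↭ₛ′ isEquivalence

  ∏-pairs : ∀ {a} {A : Set a} (f : A → Carrier) (σ : A → A) (z : Carrier) {xs} →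
            IsFixedPointFreeInvolution σ xs → (∀ {x} → x ∈ xs → f x ∙ f (σ x) ≈ z) →
            ∃[ t ] length xs ≡ t ℕ.+ t × ∏ (map f xs) ≈ ∏ (replicate t z)
  ∏-pairs f σ z inv pair = go (<-wellFounded _) inv pair
    where
    go : ∀ {xs} → Acc ℕ._<_ (length xs) → IsFixedPointFreeInvolution σ xs →
         (∀ {x} → x ∈ xs → f x ∙ f (σ x) ≈ z) → ∃[ t ] length xs ≡ t ℕ.+ t × ∏ (map f xs) ≈ ∏ (replicate t z)
    go {[]} _ _ _ = 0 , refl , ≈-refl
    go {x ∷ xs} (acc rec) inv pair with ys , x∷xs↭ ← split-pair σ inv =
      suc t , length-pairs , product-pairs
      where
      ys↭ : x ∷ σ x ∷ ys ↭ x ∷ xs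
      ys↭ = ↭-sym x∷xs↭
      length≡ : length (x ∷ xs) ≡ 2 ℕ.+ length ys
      length≡ = ↭-length x∷xs↭
      IH : ∃[ t ] length ys ≡ t ℕ.+ t × ∏ (map f ys) ≈ ∏ (replicate t z)
      IH = go (rec (subst (length ys ℕ.<_) (sym length≡) (ℕ.m<n+m (length ys) (ℕ.s≤s ℕ.z≤n))))
              (drop-pair σ (IsFixedPointFreeInvolution-resp-↭ σ x∷xs↭ inv))
              (pair ∘ ∈-resp-↭ ys↭ ∘ there ∘ there)
      t = proj₁ IH
      length-pairs : length (x ∷ xs) ≡ suc t ℕ.+ suc t
      length-pairs = trans length≡ (cong suc (trans (cong suc (proj₁ (proj₂ IH))) (sym (ℕ.+-suc t t))))
      product-pairs : ∏ (map f (x ∷ xs)) ≈ ∏ (replicate (suc t) z)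
      product-pairs = begin
        ∏ (map f (x ∷ xs))                ≈⟨ ∏-resp-↭ (map⁺ f x∷xs↭) ⟩
        f x ∙ (f (σ x) ∙ ∏ (map f ys))    ≈⟨ assoc (f x) (f (σ x)) (∏ (map f ys)) ⟨
        (f x ∙ f (σ x)) ∙ ∏ (map f ys)    ≈⟨ ∙-cong (pair (here refl)) (proj₂ (proj₂ IH)) ⟩
        z ∙ ∏ (replicate t z)             ∎

foldr-*-replicate : ∀ t c → foldr _*_ 1ℤ (replicate t c) ≡ c ^ t
foldr-*-replicate ℕ.zero    c = refl
foldr-*-replicate (suc t) c = cong (c *_) (foldr-*-replicate t c)

-1^-even : ∀ t q → t ℕ.+ t ≡ q ℕ.* 4 → -1ℤ ^ t ≡ 1ℤ
-1^-even t q t+t≡4q = begin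
  -1ℤ ^ t          ≡⟨ cong (-1ℤ ^_) t≡2q ⟩
  -1ℤ ^ (2 ℕ.* q)  ≡⟨ ℤ.^-*-assoc -1ℤ 2 q ⟨
  1ℤ ^ q           ≡⟨ ℤ.^-zeroˡ q ⟩
  1ℤ               ∎
  where
  open ≡.≡-Reasoning
  double : ∀ t → 2 ℕ.* t ≡ t ℕ.+ t
  double = ℕ-Solver.solve-∀
  quadruple : ∀ q → q ℕ.* 4 ≡ 2 ℕ.* (2 ℕ.* q)
  quadruple = ℕ-Solver.solve-∀
  t≡2q : t ≡ 2 ℕ.* q
  t≡2q = ℕ.*-cancelˡ-≡ t (2 ℕ.* q) 2 (trans (double t) (trans t+t≡4q (quadruple q)))

module ModuloPrime {p : ℕ} (p-prime : Prime p) where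

  open Modulo p public
  open CommutativeMonoidProduct *-commutativeMonoid public

  private instance
    p-nonZero : ℕ.NonZero p
    p-nonZero = prime⇒nonZero p-prime

  ∣x*y⇒∣x⊎∣y : ∀ x y → + p ∣ᶻ x * y → + p ∣ᶻ x ⊎ + p ∣ᶻ y
  ∣x*y⇒∣x⊎∣y x y p∣xy = Sum.map ∣ᵤ⇒∣ ∣ᵤ⇒∣
    (euclidsLemma ∣ x ∣ ∣ y ∣ p-prime (subst (p ∣_) (ℤ.abs-* x y) (∣⇒∣ᵤ p∣xy)))

  *-cancelˡ-≈ : ∀ {x y z} → x ≉ 0ℤ → x * y ≈ x * z → y ≈ z
  *-cancelˡ-≈ {x} {y} {z} x≉0 (congruent p∣xy-xz) =
    [ (λ p∣x → ⊥-elim (x≉0 (∣⇒≈0 p∣x))) , congruent ]′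
      (∣x*y⇒∣x⊎∣y x (y - z) (subst (+ p ∣ᶻ_) (factor x y z) p∣xy-xz))
    where
    factor : ∀ x y z → x * y - x * z ≡ x * (y - z)
    factor = solve-∀

  x*x≈1⇒x≈±1 : ∀ {x} → x * x ≈ 1ℤ → x ≈ 1ℤ ⊎ x ≈ -1ℤ
  x*x≈1⇒x≈±1 {x} (congruent p∣x²-1) =
    Sum.map congruent congruent (∣x*y⇒∣x⊎∣y (x - 1ℤ) (x - -1ℤ) (subst (+ p ∣ᶻ_) (factor x) p∣x²-1))
    where
    factor : ∀ x → x * x - 1ℤ ≡ (x - 1ℤ) * (x - -1ℤ)
    factor = solve-∀

  1≉0 : 1ℤ ≉ 0ℤ
  1≉0 1≈0 = ¬prime[1] (subst Prime (ND.∣1⇒≡1 (∣⇒∣ᵤ (≈0⇒∣ 1≈0))) p-prime)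

  -1≉0 : -1ℤ ≉ 0ℤ
  -1≉0 = 1≉0 ∘ -‿cong

  Unit : ℕ → Set
  Unit y = 0 ℕ.< y × y ℕ.< p

  unit≉0 : ∀ {y} → Unit y → + y ≉ 0ℤ
  unit≉0 (0<y , y<p) y≈0 = ℕ.<-irrefl (sym (residue-injective y<p (ℕ.<-trans 0<y y<p) y≈0)) 0<y

  private
    inverseOf : ∀ {y} → Bézout.Lemma p y → ℤ
    inverseOf (Bézout.result _ _ (Bézout.+- _ s _)) = - + s
    inverseOf (Bézout.result _ _ (Bézout.-+ _ s _)) = + s

  inverse : ℕ → ℤ
  inverse y = inverseOf (Bézout.lemma p y)

  inverse-correct : ∀ {y} → Unit y → inverse y * + y ≈ 1ℤ
  inverse-correct {y} (0<y , y<p) = correct (Bézout.lemma p y)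
    where
    instance
      y-nonZero : ℕ.NonZero y
      y-nonZero = ℕ.>-nonZero 0<y
    gcd≡1 : ∀ {d} → GCD.GCD p y d → d ≡ 1
    gcd≡1 g = GCD.unique g (coprime⇒GCD≡1 (prime⇒coprime p-prime y<p))
    lift : ∀ a b c d e → a ℕ.+ b ℕ.* c ≡ d ℕ.* e → + a + + b * + c ≡ + d * + e
    lift a b c d e eq =
      trans (cong (λ z → + a + z) (sym (ℤ.pos-* b c))) (trans (cong +_ eq) (ℤ.pos-* d e))
    negate-sum : ∀ s y → - s * y - 1ℤ ≡ - (1ℤ + s * y)
    negate-sum = solve-∀
    cancel-one : ∀ z → (1ℤ + z) - 1ℤ ≡ z
    cancel-one = solve-∀
    correct : (L : Bézout.Lemma p y) → inverseOf L * + y ≈ 1ℤ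
    correct (Bézout.result d g (Bézout.+- x s eq)) with refl ← gcd≡1 g =
      congruent (divides (- + x) (begin
        - + s * + y - 1ℤ      ≡⟨ negate-sum (+ s) (+ y) ⟩
        - (1ℤ + + s * + y)    ≡⟨ cong -_ (lift 1 s y x p eq) ⟩
        - (+ x * + p)         ≡⟨ ℤ.neg-distribˡ-* (+ x) (+ p) ⟩
        - + x * + p           ∎))
      where open ≡.≡-Reasoning
    correct (Bézout.result d g (Bézout.-+ x s eq)) with refl ← gcd≡1 g =
      congruent (divides (+ x) (begin
        + s * + y - 1ℤ           ≡⟨ cong (_- 1ℤ) (lift 1 x p s y eq) ⟨
        (1ℤ + + x * + p) - 1ℤ    ≡⟨ cancel-one (+ x * + p) ⟩
        + x * + p                ∎))
      where open ≡.≡-Reasoning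

  partner : ℤ → ℕ → ℕ
  partner c y = (c * inverse y) %ℕ p

  partner-correct : ∀ c {y} → Unit y → + y * + partner c y ≈ c
  partner-correct c {y} u = begin
    + y * + partner c y     ≈⟨ *-congˡ (+ y) (%ℕ-≈ (c * inverse y)) ⟩
    + y * (c * inverse y)   ≡⟨ rearrange (+ y) c (inverse y) ⟩
    c * (inverse y * + y)   ≈⟨ *-congˡ c (inverse-correct u) ⟩
    c * 1ℤ                  ≡⟨ ℤ.*-identityʳ c ⟩
    c                       ∎
    where
    open ≈-Reasoning
    rearrange : ∀ y c v → y * (c * v) ≡ c * (v * y)
    rearrange = solve-∀

  partner-unit : ∀ {c y} → c ≉ 0ℤ → Unit y → Unit (partner c y)
  partner-unit {c} {y} c≉0 u = ℕ.n≢0⇒n>0 partner≢0 , n%ℕd<d (c * inverse y) p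
    where
    partner≢0 : partner c y ≢ 0
    partner≢0 eq = c≉0 (begin
      c                      ≈⟨ partner-correct c u ⟨
      + y * + partner c y    ≡⟨ cong (λ v → + y * + v) eq ⟩
      + y * 0ℤ               ≡⟨ ℤ.*-zeroʳ (+ y) ⟩
      0ℤ                     ∎)
      where open ≈-Reasoning

  partner-involutive : ∀ {c y} → c ≉ 0ℤ → Unit y → partner c (partner c y) ≡ y
  partner-involutive {c} {y} c≉0 u =
    residue-injective (proj₂ (partner-unit c≉0 u′)) (proj₂ u) (*-cancelˡ-≈ (unit≉0 u′) (begin
      + partner c y * + partner c (partner c y)  ≈⟨ partner-correct c u′ ⟩
      c                                          ≈⟨ partner-correct c u ⟨
      + y * + partner c y                        ≡⟨ ℤ.*-comm (+ y) (+ partner c y) ⟩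
      + partner c y * + y                        ∎))
    where
    open ≈-Reasoning
    u′ = partner-unit c≉0 u

  partner-isFixedPointFreeInvolution : ∀ {c xs} → c ≉ 0ℤ → Unique xs → (∀ {y} → y ∈ xs → Unit y) →
    (∀ {y} → y ∈ xs → partner c y ∈ xs) → (∀ {y} → y ∈ xs → + y * + y ≉ c) →
    IsFixedPointFreeInvolution (partner c) xs
  partner-isFixedPointFreeInvolution {c} c≉0 unique unit closed no-root = record
    { unique     = unique
    ; closed     = closed
    ; fixedFree  = λ {y} y∈ eq → no-root y∈ (subst (λ v → + y * + v ≈ c) eq (partner-correct c (unit y∈)))
    ; involutive = partner-involutive c≉0 ∘ unit
    }

-- The odd prime p = 3 + r; units lists 1, …, p − 1 with 1 and p − 1 ≡ −1 in front.
module Wilson (r : ℕ) (p-prime : Prime (3 ℕ.+ r)) where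

  open ModuloPrime p-prime

  units∖±1 : List ℕ
  units∖±1 = applyUpTo (2 ℕ.+_) r

  units : List ℕ
  units = 1 ∷ 2 ℕ.+ r ∷ units∖±1

  p-1≈-1 : + (2 ℕ.+ r) ≈ -1ℤ
  p-1≈-1 = congruent (divides 1ℤ (trans (cong +_ (ℕ.+-comm (2 ℕ.+ r) 1)) (sym (ℤ.*-identityˡ _))))

  ∈-units∖±1⁻ : ∀ {y} → y ∈ units∖±1 → 2 ℕ.≤ y × y ℕ.< 2 ℕ.+ r
  ∈-units∖±1⁻ y∈ with i , i<r , refl ← ∈-applyUpTo⁻ (2 ℕ.+_) y∈ =
    ℕ.s≤s (ℕ.s≤s ℕ.z≤n) , ℕ.s≤s (ℕ.s≤s i<r)

  ∈-units∖±1⇒≢1 : ∀ {y} → y ∈ units∖±1 → y ≢ 1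
  ∈-units∖±1⇒≢1 y∈ refl = ℕ.<-irrefl refl (proj₁ (∈-units∖±1⁻ y∈))

  ∈-units∖±1⇒≢p-1 : ∀ {y} → y ∈ units∖±1 → y ≢ 2 ℕ.+ r
  ∈-units∖±1⇒≢p-1 y∈ refl = ℕ.<-irrefl refl (proj₂ (∈-units∖±1⁻ y∈))

  ∈-units⁻ : ∀ {y} → y ∈ units → Unit y
  ∈-units⁻ (here refl)         = ℕ.s≤s ℕ.z≤n , ℕ.s≤s (ℕ.s≤s ℕ.z≤n)
  ∈-units⁻ (there (here refl)) = ℕ.s≤s ℕ.z≤n , ℕ.n<1+n _
  ∈-units⁻ (there (there y∈)) with 2≤y , y<p-1 ← ∈-units∖±1⁻ y∈ =
    ℕ.<-≤-trans (ℕ.s≤s ℕ.z≤n) 2≤y , ℕ.<-trans y<p-1 (ℕ.n<1+n _)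

  ∈-units⁺ : ∀ {y} → Unit y → y ∈ units
  ∈-units⁺ {1} _ = here refl
  ∈-units⁺ {suc (suc i)} (_ , ℕ.s≤s y≤p-1) with suc (suc i) ℕ.≟ 2 ℕ.+ r
  ... | yes y≡p-1 = there (here y≡p-1)
  ... | no y≢p-1 with ℕ.s≤s (ℕ.s≤s i<r) ← ℕ.≤∧≢⇒< y≤p-1 y≢p-1 =
    there (there (∈-applyUpTo⁺ (2 ℕ.+_) i<r))

  ∈-units∖±1⁺ : ∀ {y} → Unit y → y ≢ 1 → y ≢ 2 ℕ.+ r → y ∈ units∖±1
  ∈-units∖±1⁺ u y≢1 y≢p-1 with ∈-units⁺ u
  ... | here y≡1           = ⊥-elim (y≢1 y≡1)
  ... | there (here y≡p-1) = ⊥-elim (y≢p-1 y≡p-1)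
  ... | there (there y∈)   = y∈

  units∖±1-unique : Unique units∖±1
  units∖±1-unique = applyUpTo⁺₁ (2 ℕ.+_) r (λ i<j _ → ℕ.<⇒≢ (ℕ.s≤s (ℕ.s≤s i<j)))

  units-unique : Unique units
  units-unique = All.tabulate 1∉ ∷ All.tabulate (λ y∈ → ∈-units∖±1⇒≢p-1 y∈ ∘ sym) ∷ units∖±1-unique
    where
    1∉ : ∀ {y} → y ∈ 2 ℕ.+ r ∷ units∖±1 → 1 ≢ y
    1∉ (here refl) ()
    1∉ (there y∈)  = ∈-units∖±1⇒≢1 y∈ ∘ sym

  unit≈1⇒≡1 : ∀ {y} → Unit y → + y ≈ 1ℤ → y ≡ 1
  unit≈1⇒≡1 u = residue-injective (proj₂ u) (ℕ.s≤s (ℕ.s≤s ℕ.z≤n))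

  unit≈-1⇒≡p-1 : ∀ {y} → Unit y → + y ≈ -1ℤ → y ≡ 2 ℕ.+ r
  unit≈-1⇒≡p-1 u y≈-1 = residue-injective (proj₂ u) (ℕ.n<1+n _) (≈-trans y≈-1 (≈-sym p-1≈-1))

  ∈-units∖±1⇒unit : ∀ {y} → y ∈ units∖±1 → Unit y
  ∈-units∖±1⇒unit = ∈-units⁻ ∘ there ∘ there

  ∈-units∖±1⇒partner-1∈ : ∀ {y} → y ∈ units∖±1 → partner 1ℤ y ∈ units∖±1
  ∈-units∖±1⇒partner-1∈ {y} y∈ = ∈-units∖±1⁺ (partner-unit 1≉0 u) partner≢1 partner≢p-1
    where
    open ≈-Reasoning
    u = ∈-units∖±1⇒unit y∈
    negate : ∀ y → y ≡ - (y * -1ℤ)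
    negate = solve-∀
    partner≢1 : partner 1ℤ y ≢ 1
    partner≢1 eq = ∈-units∖±1⇒≢1 y∈ (unit≈1⇒≡1 u (begin
      + y                  ≡⟨ ℤ.*-identityʳ (+ y) ⟨
      + y * + 1            ≡⟨ cong (λ v → + y * + v) eq ⟨
      + y * + partner 1ℤ y ≈⟨ partner-correct 1ℤ u ⟩
      1ℤ                   ∎))
    partner≢p-1 : partner 1ℤ y ≢ 2 ℕ.+ r
    partner≢p-1 eq = ∈-units∖±1⇒≢p-1 y∈ (unit≈-1⇒≡p-1 u (begin
      + y                        ≡⟨ negate (+ y) ⟩
      - (+ y * -1ℤ)              ≈⟨ -‿cong (*-congˡ (+ y) p-1≈-1) ⟨
      - (+ y * + (2 ℕ.+ r))      ≡⟨ cong (λ v → - (+ y * + v)) eq ⟨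
      - (+ y * + partner 1ℤ y)   ≈⟨ -‿cong (partner-correct 1ℤ u) ⟩
      -1ℤ                        ∎))

  ∈-units∖±1⇒y²≉1 : ∀ {y} → y ∈ units∖±1 → + y * + y ≉ 1ℤ
  ∈-units∖±1⇒y²≉1 y∈ y²≈1 =
    [ ∈-units∖±1⇒≢1 y∈ ∘ unit≈1⇒≡1 u , ∈-units∖±1⇒≢p-1 y∈ ∘ unit≈-1⇒≡p-1 u ]′ (x*x≈1⇒x≈±1 y²≈1)
    where u = ∈-units∖±1⇒unit y∈

  ∏units∖±1≈1 : ∏ (map +_ units∖±1) ≈ 1ℤ
  ∏units∖±1≈1 = ≈-trans (proj₂ (proj₂ pairs))
    (≈-reflexive (trans (foldr-*-replicate (proj₁ pairs) 1ℤ) (ℤ.^-zeroˡ (proj₁ pairs))))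
    where
    pairs : ∃[ t ] length units∖±1 ≡ t ℕ.+ t × ∏ (map +_ units∖±1) ≈ ∏ (replicate t 1ℤ)
    pairs = ∏-pairs +_ (partner 1ℤ) 1ℤ
      (partner-isFixedPointFreeInvolution 1≉0 units∖±1-unique ∈-units∖±1⇒unit
        ∈-units∖±1⇒partner-1∈ ∈-units∖±1⇒y²≉1)
      (partner-correct 1ℤ ∘ ∈-units∖±1⇒unit)

  wilson : ∏ (map +_ units) ≈ -1ℤ
  wilson = *-congˡ 1ℤ (*-cong p-1≈-1 ∏units∖±1≈1)

  ¬¬-1-isSquare : 4 ∣ 2 ℕ.+ r → ¬ ¬ (∃[ i ] + toℕ i * + toℕ i ≈ -1ℤ)
  ¬¬-1-isSquare (ND.divides q p-1≡q*4) ∄root = 1≉-1 (ℕ.s≤s (ℕ.s≤s (ℕ.s≤s ℕ.z≤n))) (begin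
    1ℤ                   ≡⟨ -1^-even t q t+t≡4q ⟨
    -1ℤ ^ t              ≡⟨ foldr-*-replicate t -1ℤ ⟨
    ∏ (replicate t -1ℤ)  ≈⟨ proj₂ (proj₂ pairs) ⟨
    ∏ (map +_ units)     ≈⟨ wilson ⟩
    -1ℤ                  ∎)
    where
    open ≈-Reasoning
    no-root : ∀ {y} → y ∈ units → + y * + y ≉ -1ℤ
    no-root y∈ y²≈-1 = ∄root (fromℕ< y<p , subst (λ v → + v * + v ≈ -1ℤ) (sym (toℕ-fromℕ< y<p)) y²≈-1)
      where y<p = proj₂ (∈-units⁻ y∈)
    pairs : ∃[ t ] length units ≡ t ℕ.+ t × ∏ (map +_ units) ≈ ∏ (replicate t -1ℤ)
    pairs = ∏-pairs +_ (partner -1ℤ) -1ℤ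
      (partner-isFixedPointFreeInvolution -1≉0 units-unique ∈-units⁻
        (∈-units⁺ ∘ partner-unit -1≉0 ∘ ∈-units⁻) no-root)
      (partner-correct -1ℤ ∘ ∈-units⁻)
    t = proj₁ pairs
    t+t≡4q : t ℕ.+ t ≡ q ℕ.* 4
    t+t≡4q = trans (sym (proj₁ (proj₂ pairs))) (trans (cong (2 ℕ.+_) (length-applyUpTo (2 ℕ.+_) r)) p-1≡q*4)

  -1-isSquare : 4 ∣ 2 ℕ.+ r → ∃[ i ] i * i ≈ -1ℤ
  -1-isSquare 4∣p-1 = Σ.map (+_ ∘ toℕ) id
    (Dec.decidable-stable (any? λ i → + toℕ i * + toℕ i ≈? -1ℤ) (¬¬-1-isSquare 4∣p-1))

expo≡2+d : ∀ {k n} → k < + n → ∃[ d ] expo k n ≡ 2 ℕ.+ d × + n ≡ k + + suc d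
expo≡2+d {k} {n} k<n = d , trans (cong (λ x → ∣ x + 1ℤ ∣) n-k≡) (ℕ.+-comm (suc d) 1) , n≡
  where
  d = ∣ + n - (1ℤ + k) ∣
  peel-one : ∀ n k → n - k ≡ 1ℤ + (n - (1ℤ + k))
  peel-one = solve-∀
  split : ∀ n k → n ≡ k + (n - k)
  split = solve-∀
  n-k≡ : + n - k ≡ + suc d
  n-k≡ = trans (peel-one (+ n) k)
    (cong (λ z → 1ℤ + z) (sym (ℤ.0≤i⇒+∣i∣≡i (ℤ.i≤j⇒0≤j-i (ℤ.i<j⇒suc[i]≤j k<n)))))
  n≡ : + n ≡ k + + suc d
  n≡ = trans (split (+ n) k) (cong (λ z → k + z) n-k≡)

%≡1⇒∣pred : ∀ m n .{{_ : ℕ.NonZero n}} → m % n ≡ 1 → n ∣ ℕ.pred m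
%≡1⇒∣pred m n m%n≡1 =
  ND.divides (m ℕ./ n) (cong ℕ.pred (trans (ℕ.m≡m%n+[m/n]*n m n) (cong (ℕ._+ (m ℕ./ n) ℕ.* n) m%n≡1)))

¬4∣2^[2+d]-2 : ∀ d → ¬ (4 ∣ ∣ (+ 2) ^ (2 ℕ.+ d) - + 2 ∣)
¬4∣2^[2+d]-2 d 4∣2ᵉ-2 = ND.>⇒∤ (ℕ.s≤s (ℕ.s≤s (ℕ.s≤s ℕ.z≤n))) (∣⇒∣ᵤ (subst (+ 4 ∣ᶻ_) (cancel ((+ 2) ^ (2 ℕ.+ d)))
  (∣m∣n⇒∣m-n (divides ((+ 2) ^ d) (quadruple ((+ 2) ^ d))) (∣ᵤ⇒∣ 4∣2ᵉ-2))))
  where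
  quadruple : ∀ x → + 2 * (+ 2 * x) ≡ x * + 4
  quadruple = solve-∀
  cancel : ∀ y → y - (y - + 2) ≡ + 2
  cancel = solve-∀

even-residue⇒≡2 : ∀ {p r} → Prime p → p % 4 ≡ r → 2 ∣ r → p ≡ 2
even-residue⇒≡2 p-prime p%4≡r 2∣r = [ (λ ()) , sym ]′
  (prime⇒irreducible p-prime (ND.∣n∣m%n⇒∣m (ND.divides 2 refl) (subst (2 ∣_) (sym p%4≡r) 2∣r)))

prime-residue-mod4 : ∀ {p} → Prime p → p ≡ 2 ⊎ p % 4 ≡ 1 ⊎ p % 4 ≡ 3
prime-residue-mod4 {p} p-prime with p % 4 in p%4≡r | ℕ.m%n<n p 4
... | 0 | _ = inj₁ (even-residue⇒≡2 p-prime p%4≡r (ND.divides 0 refl))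
... | 1 | _ = inj₂ (inj₁ refl)
... | 2 | _ = inj₁ (even-residue⇒≡2 p-prime p%4≡r ND.∣-refl)
... | 3 | _ = inj₂ (inj₂ refl)
... | suc (suc (suc (suc _))) | ℕ.s≤s (ℕ.s≤s (ℕ.s≤s (ℕ.s≤s ())))

prime%4≡1⇒2<p : ∀ {p} → Prime p → p % 4 ≡ 1 → 2 ℕ.< p
prime%4≡1⇒2<p {0} p-prime _ = ⊥-elim (¬prime[0] p-prime)
prime%4≡1⇒2<p {1} p-prime _ = ⊥-elim (¬prime[1] p-prime)
prime%4≡1⇒2<p {suc (suc (suc _))} _ _ = ℕ.s≤s (ℕ.s≤s (ℕ.s≤s ℕ.z≤n))

p%4≡1⇒-1-isSquare : ∀ {p} → Prime p → p % 4 ≡ 1 → ∃[ i ] Modulo._≈_ p (i * i) -1ℤ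
p%4≡1⇒-1-isSquare {p} p-prime p%4≡1 =
  by-quotient (p ℕ./ 4) p-prime (trans (ℕ.m≡m%n+[m/n]*n p 4) (cong (ℕ._+ (p ℕ./ 4) ℕ.* 4) p%4≡1))
  where
  by-quotient : ∀ {p} q → Prime p → p ≡ 1 ℕ.+ q ℕ.* 4 → ∃[ i ] Modulo._≈_ p (i * i) -1ℤ
  by-quotient 0       p-prime refl = ⊥-elim (¬prime[1] p-prime)
  by-quotient (suc q) p-prime refl = Wilson.-1-isSquare (2 ℕ.+ q ℕ.* 4) p-prime (ND.divides (suc q) refl)

prime∣n∈C⇒p%4≢1 : ∀ {k n p} → (+ 4) ℤd.∣ k → InC k n → Prime p → p ∣ n → p % 4 ≢ 1
prime∣n∈C⇒p%4≢1 {k} {n} {p} 4∣k (_ , k<n , aᵉ≈a) p-prime p∣n p%4≡1 = ¬4∣2^[2+d]-2 d 4∣2ᵉ-2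
  where
  open Modulo p using (congruent; 1≉-1; iᵉ≈i⇒e%4≡1)
  e = expo k n
  √-1 = p%4≡1⇒-1-isSquare p-prime p%4≡1
  e%4≡1 : e % 4 ≡ 1
  e%4≡1 = iᵉ≈i⇒e%4≡1 (1≉-1 (prime%4≡1⇒2<p p-prime p%4≡1)) e (proj₂ √-1)
    (congruent (∣ᵤ⇒∣ (ND.∣-trans p∣n (aᵉ≈a (proj₁ √-1)))))
  d = proj₁ (expo≡2+d k<n)
  e≡2+d : e ≡ 2 ℕ.+ d
  e≡2+d = proj₁ (proj₂ (expo≡2+d k<n))
  n≡k+1+d : + n ≡ k + + suc d
  n≡k+1+d = proj₂ (proj₂ (expo≡2+d k<n))
  4∣1+d : 4 ∣ suc d
  4∣1+d = subst (4 ∣_) (cong ℕ.pred e≡2+d) (%≡1⇒∣pred e 4 e%4≡1)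
  4∣n : 4 ∣ n
  4∣n = ∣⇒∣ᵤ (subst (+ 4 ∣ᶻ_) (sym n≡k+1+d) (∣m∣n⇒∣m+n (∣ᵤ⇒∣ {+ 4} {k} 4∣k) (∣ᵤ⇒∣ {+ 4} {+ suc d} 4∣1+d)))
  4∣2ᵉ-2 : 4 ∣ ∣ (+ 2) ^ (2 ℕ.+ d) - + 2 ∣
  4∣2ᵉ-2 = ND.∣-trans 4∣n (subst (λ e → n ∣ ∣ (+ 2) ^ e - + 2 ∣) e≡2+d (aᵉ≈a (+ 2)))

proposition4p3 : (k : ℤ) → (+ 4) ℤd.∣ k → (n : ℕ) → InC k n →
                 (p : ℕ) → Prime p → p ∣ n → p ≡ 2 ⊎ p % 4 ≡ 3
proposition4p3 k 4∣k n n∈Cₖ p p-prime p∣n =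
  [ inj₁ , [ ⊥-elim ∘ prime∣n∈C⇒p%4≢1 4∣k n∈Cₖ p-prime p∣n , inj₂ ]′ ]′ (prime-residue-mod4 p-prime)
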